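{- Let $a_{n,j}$ denote the number of partial skew Motzkin paths of length $n$ that end at height $j$ (defined in the context). Put $$W=\sqrt{(1-z)(1-3z-z^2-z^3)}=\sqrt{1-4z+2z^2+z^4},$$ $$u_1=\frac{1-z+z^2+z^3+(1+z)W}{2z},\qquad u_2=\frac{1-z+z^2+z^3-(1+z)W}{2z},$$ where the square root is the branch with value $1$ at $z=0$. Then for every integer $j\ge 0$, as formal power series in $z$, $$\sum_{n\ge0}a_{n,j}z^n=\frac{1+z-2z^2-z^3+z\,u_2}{z(1+z)\,u_1^{\,j+1}}.$$
   Context: A partial skew Motzkin path of length $n$ is a word $s_1s_2\cdots s_n$ over the four-letter alphabet $\{U,D,R,L\}$, where $U$ (up-step) has displacement $(1,1)$, $D$ (down-step) has displacement $(1,-1)$, $R$ (red step) also has displacement $(1,-1)$ but is a different letter from $D$, and $L$ (level step) has displacement $(1,0)$. The path starts at $(0,0)$; its height after $i$ steps is the sum of the vertical displacements of $s_1,\dots,s_i$. The conditions are: (i) the height never becomes negative; (ii) no $U$ is immediately followed by $R$, and no $R$ is immediately followed by $U$. (The red step $R$ models a left step $(-1,-1)$ in a skew path which may not intersect itself.) The path ends at height $j$ if its height after all $n$ steps is $j$; the empty path (length $0$) ends at height $0$. -}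

module Defs where

open import Data.Nat as ℕ using (ℕ; zero; suc; _∸_)
open import Data.Bool using (Bool; true; false; _∧_; not)
open import Data.Maybe using (Maybe; just; nothing)
open import Data.List using (List; []; _∷_; map; concatMap; filterᵇ; length)
open import Data.Integer using (ℤ; +_)
open import Data.Rational using (ℚ; 0ℚ; 1ℚ; _+_; _*_; -_; _/_)
open import Relation.Binary.PropositionalEquality using (_≡_)

-- U = (1,1), D = (1,-1), R = red step (1,-1), L = level step (1,0)
data Step : Set where
  U D R L : Step

allSteps : List Step
allSteps = U ∷ D ∷ R ∷ L ∷ []

words : ℕ → List (List Step)
words zero    = [] ∷ []
words (suc n) = concatMap (λ w → map (λ s → s ∷ w) allSteps) (words n)

step : ℕ → Step → Maybe ℕ
step h U = just (suc h)
step h L = just h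
step zero D = nothing
step (suc h) D = just h
step zero R = nothing
step (suc h) R = just h

run : ℕ → List Step → Maybe ℕ
run h [] = just h
run h (s ∷ w) with step h s
... | nothing = nothing
... | just h' = run h' w

forbiddenPair : Step → Step → Bool
forbiddenPair U R = true
forbiddenPair R U = true
forbiddenPair _ _ = false

noForbidden : List Step → Bool
noForbidden [] = true
noForbidden (s ∷ []) = true
noForbidden (s ∷ t ∷ w) = not (forbiddenPair s t) ∧ noForbidden (t ∷ w)

endsAt : Maybe ℕ → ℕ → Bool
endsAt nothing  j = false
endsAt (just h) j = h ℕ.≡ᵇ j

isPSMP : ℕ → List Step → Bool
isPSMP j w = noForbidden w ∧ endsAt (run 0 w) j

a : ℕ → ℕ → ℕ
a n j = length (filterᵇ (isPSMP j) (words n))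

Series : Set
Series = ℕ → ℚ

_≈ₛ_ : Series → Series → Set
f ≈ₛ g = ∀ n → f n ≡ g n

infix 4 _≈ₛ_
infixl 6 _⊕_ _⊖_
infixl 7 _⊗_

_⊕_ : Series → Series → Series
(f ⊕ g) n = f n + g n

_⊖_ : Series → Series → Series
(f ⊖ g) n = f n + (- g n)

conv : Series → Series → ℕ → ℕ → ℚ
conv f g n zero    = f 0 * g n
conv f g n (suc k) = conv f g n k + f (suc k) * g (n ∸ suc k)

_⊗_ : Series → Series → Series
(f ⊗ g) n = conv f g n n

-- polynomial with given list of coefficients (constant term first)
poly : List ℚ → Series
poly []       n       = 0ℚ
poly (c ∷ cs) zero    = c
poly (c ∷ cs) (suc n) = poly cs n

int : ℤ → ℚ
int k = k / 1

one : Series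
one = poly (1ℚ ∷ [])

zS : Series
zS = poly (0ℚ ∷ 1ℚ ∷ [])

_^ₛ_ : Series → ℕ → Series
f ^ₛ zero  = one
f ^ₛ suc k = f ⊗ (f ^ₛ k)

const : ℚ → Series
const c = poly (c ∷ [])

A : ℕ → Series
A j n = int (+ a n j)

Wsq : Series
Wsq = poly (1ℚ ∷ int (Data.Integer.-[1+ 3 ]) ∷ int (+ 2) ∷ 0ℚ ∷ 1ℚ ∷ [])

P : Series
P = poly (1ℚ ∷ (- 1ℚ) ∷ 1ℚ ∷ 1ℚ ∷ [])

Q : Series
Q = poly (1ℚ ∷ 1ℚ ∷ int (Data.Integer.-[1+ 1 ]) ∷ (- 1ℚ) ∷ [])

onePlusZ : Series
onePlusZ = poly (1ℚ ∷ 1ℚ ∷ [])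

-- Given W, the numerators 2z·u₁ and 2z·u₂ (these are power series)
twoZu₁ : Series → Series
twoZu₁ W = P ⊕ onePlusZ ⊗ W

twoZu₂ : Series → Series
twoZu₂ W = P ⊖ onePlusZ ⊗ W

half : ℚ
half = + 1 / 2

twoZ : Series
twoZ = poly (0ℚ ∷ int (+ 2) ∷ [])

module Submission where

-- A path can be extended by a step s exactly when s keeps the height nonnegative and is not forbidden
-- after the last step, and the latter only depends on whether that last step is U, R or something else.
-- Removing the last step therefore gives a linear system for the generating functions X c j of the paths
-- ending at height j with a last step of kind c. Multiplying X c j by (2z u₁)^(j+1) gives a system of
-- the same shape whose leading coefficient is the constant term 2 of 2z u₁; such a system has at most
-- one solution, as each equation determines the n-th coefficient of an unknown from the earlier ones.
-- An explicit solution, (2z)^j times a polynomial in z and W, is checked with the ring solver modulo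
-- W² = 1 - 4z + 2z² + z⁴, and summing it over the three kinds gives the formula.

open import Defs
open import Data.Nat using (ℕ; suc)
open import Data.Rational using (1ℚ)
open import Relation.Binary.PropositionalEquality using (_≡_)

open import Algebra.Bundles using (CommutativeRing; CommutativeMonoid)
open import Algebra.Structures using (IsCommutativeRing)
import Algebra.Construct.Pointwise as Pointwise
import Algebra.Properties.CommutativeSemigroup as CommutativeSemigroupProperties
import Algebra.Solver.Ring.AlmostCommutativeRing as ACR
open import Data.Bool using (Bool; true; false; _∧_; not)
open import Data.Bool.Properties using (∧-assoc; ∧-comm; ∧-identityʳ; ∧-zeroʳ)
import Data.Integer as ℤ
import Data.Integer.Properties as ℤP
open import Data.List using (List; []; _∷_; _++_; _∷ʳ_; filterᵇ; length; map; concatMap)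
open import Data.Maybe using (Maybe; just; nothing)
open import Data.Nat as ℕ using (ℕ; zero; suc; _∸_; z≤n; _<_)
import Data.Nat.Properties as ℕP
import Data.Nat.Coprimality as Coprimality
open import Data.Product using (_,_; proj₁; curry; uncurry)
open import Data.Rational using (ℚ; 0ℚ; 1ℚ; _+_; _*_; -_; mkℚ; 1/_; ≢-nonZero)
import Data.Rational.Properties as ℚP
open import Algebra.Properties.Group ℚP.+-0-group using (∙-cancelʳ)
open import Data.Sum using (inj₁; inj₂)
open import Function using (_∘_)
open import Relation.Binary.PropositionalEquality
import Relation.Binary.Reasoning.Setoid as SetoidReasoning
open import Relation.Nullary using (yes; no)

indicator : Bool → ℕ
indicator true  = 1
indicator false = 0

indicator-∧ : ∀ a b → indicator (a ∧ b) ≡ indicator a ℕ.* indicator b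
indicator-∧ false b = refl
indicator-∧ true  b = sym (ℕP.+-identityʳ (indicator b))

private variable
  I I′ : Set

sumBy : (I → ℕ) → List I → ℕ
sumBy f []       = 0
sumBy f (x ∷ xs) = f x ℕ.+ sumBy f xs

sumBy-zero : (xs : List I) → sumBy (λ _ → 0) xs ≡ 0
sumBy-zero []       = refl
sumBy-zero (x ∷ xs) = sumBy-zero xs

sumBy-cong : ∀ {f g : I → ℕ} xs → (∀ x → f x ≡ g x) → sumBy f xs ≡ sumBy g xs
sumBy-cong []       f≗g = refl
sumBy-cong (x ∷ xs) f≗g = cong₂ ℕ._+_ (f≗g x) (sumBy-cong xs f≗g)

sumBy-+ : ∀ (f g : I → ℕ) xs → sumBy (λ x → f x ℕ.+ g x) xs ≡ sumBy f xs ℕ.+ sumBy g xs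
sumBy-+ f g []       = refl
sumBy-+ f g (x ∷ xs) = trans (cong (f x ℕ.+ g x ℕ.+_) (sumBy-+ f g xs))
                             (interchange (f x) (g x) (sumBy f xs) (sumBy g xs))
  where open CommutativeSemigroupProperties ℕP.+-commutativeSemigroup using (interchange)

sumBy-*ˡ : ∀ k (f : I → ℕ) xs → sumBy (λ x → k ℕ.* f x) xs ≡ k ℕ.* sumBy f xs
sumBy-*ˡ k f []       = sym (ℕP.*-zeroʳ k)
sumBy-*ˡ k f (x ∷ xs) = trans (cong (k ℕ.* f x ℕ.+_) (sumBy-*ˡ k f xs))
                              (sym (ℕP.*-distribˡ-+ k (f x) (sumBy f xs)))

sumBy-++ : ∀ (f : I → ℕ) xs ys → sumBy f (xs ++ ys) ≡ sumBy f xs ℕ.+ sumBy f ys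
sumBy-++ f []       ys = refl
sumBy-++ f (x ∷ xs) ys = trans (cong (f x ℕ.+_) (sumBy-++ f xs ys))
                               (sym (ℕP.+-assoc (f x) (sumBy f xs) (sumBy f ys)))

sumBy-map : ∀ (f : I → ℕ) (g : I′ → I) xs → sumBy f (map g xs) ≡ sumBy (f ∘ g) xs
sumBy-map f g []       = refl
sumBy-map f g (x ∷ xs) = cong (f (g x) ℕ.+_) (sumBy-map f g xs)

sumBy-swap : ∀ (f : I → I′ → ℕ) xs ys →
  sumBy (λ x → sumBy (f x) ys) xs ≡ sumBy (λ y → sumBy (λ x → f x y) xs) ys
sumBy-swap f []       ys = sym (sumBy-zero ys)
sumBy-swap f (x ∷ xs) ys = trans (cong (sumBy (f x) ys ℕ.+_) (sumBy-swap f xs ys))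
                                 (sym (sumBy-+ (f x) (λ y → sumBy (λ x → f x y) xs) ys))

length-filterᵇ : ∀ p (xs : List I) → length (filterᵇ p xs) ≡ sumBy (indicator ∘ p) xs
length-filterᵇ p []       = refl
length-filterᵇ p (x ∷ xs) with p x
... | true  = cong suc (length-filterᵇ p xs)
... | false = length-filterᵇ p xs

sumBy-words-∷ : ∀ f n → sumBy f (words (suc n)) ≡ sumBy (λ s → sumBy (f ∘ (s ∷_)) (words n)) allSteps
sumBy-words-∷ f n = go (words n)
  where
  go : ∀ ws → sumBy f (concatMap (λ w → map (_∷ w) allSteps) ws)
            ≡ sumBy (λ s → sumBy (f ∘ (s ∷_)) ws) allSteps
  go []       = refl
  go (w ∷ ws) = begin
    sumBy f (map (_∷ w) allSteps ++ concatMap (λ w → map (_∷ w) allSteps) ws)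
      ≡⟨ sumBy-++ f (map (_∷ w) allSteps) (concatMap (λ w → map (_∷ w) allSteps) ws) ⟩
    sumBy f (map (_∷ w) allSteps) ℕ.+ sumBy f (concatMap (λ w → map (_∷ w) allSteps) ws)
      ≡⟨ cong₂ ℕ._+_ (sumBy-map f (_∷ w) allSteps) (go ws) ⟩
    sumBy (λ s → f (s ∷ w)) allSteps ℕ.+ sumBy (λ s → sumBy (f ∘ (s ∷_)) ws) allSteps
      ≡⟨ sumBy-+ (λ s → f (s ∷ w)) (λ s → sumBy (f ∘ (s ∷_)) ws) allSteps ⟨
    sumBy (λ s → sumBy (f ∘ (s ∷_)) (w ∷ ws)) allSteps ∎
    where open ≡-Reasoning

sumBy-words-∷ʳ : ∀ f n → sumBy f (words (suc n)) ≡ sumBy (λ s → sumBy (λ w → f (w ∷ʳ s)) (words n)) allSteps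
sumBy-words-∷ʳ f zero    = sumBy-words-∷ f zero
sumBy-words-∷ʳ f (suc n) = begin
  sumBy f (words (suc (suc n)))
    ≡⟨ sumBy-words-∷ f (suc n) ⟩
  sumBy (λ t → sumBy (λ w → f (t ∷ w)) (words (suc n))) allSteps
    ≡⟨ sumBy-cong allSteps (λ t → sumBy-words-∷ʳ (f ∘ (t ∷_)) n) ⟩
  sumBy (λ t → sumBy (λ s → sumBy (λ w → f (t ∷ w ∷ʳ s)) (words n)) allSteps) allSteps
    ≡⟨ sumBy-swap (λ t s → sumBy (λ w → f (t ∷ w ∷ʳ s)) (words n)) allSteps allSteps ⟩
  sumBy (λ s → sumBy (λ t → sumBy (λ w → f (t ∷ w ∷ʳ s)) (words n)) allSteps) allSteps
    ≡⟨ sumBy-cong allSteps (λ s → sumBy-words-∷ (λ w → f (w ∷ʳ s)) n) ⟨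
  sumBy (λ s → sumBy (λ w → f (w ∷ʳ s)) (words (suc n))) allSteps ∎
  where open ≡-Reasoning

-- Paths by final height and kind of last step

data Last : Set where
  up red other : Last

lastOf : Step → Last
lastOf U = up
lastOf R = red
lastOf D = other
lastOf L = other

_≡ᴸ_ : Last → Last → Bool
up    ≡ᴸ up    = true
red   ≡ᴸ red   = true
other ≡ᴸ other = true
_     ≡ᴸ _     = false

-- The empty path constrains the next step no more than a level step does.
lastStep : List Step → Step
lastStep []          = L
lastStep (s ∷ [])    = s
lastStep (_ ∷ t ∷ w) = lastStep (t ∷ w)

stepᵐ : Maybe ℕ → Step → Maybe ℕ
stepᵐ nothing  s = nothing
stepᵐ (just h) s = step h s

lastStep-∷ʳ : ∀ w s → lastStep (w ∷ʳ s) ≡ s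
lastStep-∷ʳ []          s = refl
lastStep-∷ʳ (_ ∷ [])    s = refl
lastStep-∷ʳ (_ ∷ t ∷ w) s = lastStep-∷ʳ (t ∷ w) s

run-∷ʳ : ∀ h w s → run h (w ∷ʳ s) ≡ stepᵐ (run h w) s
run-∷ʳ h []      s with step h s
... | nothing = refl
... | just _  = refl
run-∷ʳ h (t ∷ w) s with step h t
... | nothing = refl
... | just h′ = run-∷ʳ h′ w s

noForbidden-∷ʳ : ∀ w s → noForbidden (w ∷ʳ s) ≡ noForbidden w ∧ not (forbiddenPair (lastStep w) s)
noForbidden-∷ʳ []          s = refl
noForbidden-∷ʳ (t ∷ [])    s = ∧-identityʳ (not (forbiddenPair t s))
noForbidden-∷ʳ (t ∷ u ∷ w) s = trans (cong (not (forbiddenPair t u) ∧_) (noForbidden-∷ʳ (u ∷ w) s))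
                                     (sym (∧-assoc (not (forbiddenPair t u)) (noForbidden (u ∷ w)) _))

isPSMP-∷ʳ : ∀ j w s → isPSMP j (w ∷ʳ s)
  ≡ (noForbidden w ∧ endsAt (stepᵐ (run 0 w) s) j) ∧ not (forbiddenPair (lastStep w) s)
isPSMP-∷ʳ j w s rewrite noForbidden-∷ʳ w s | run-∷ʳ 0 w s = swap (noForbidden w) _ _
  where
  swap : ∀ a b c → (a ∧ b) ∧ c ≡ (a ∧ c) ∧ b
  swap false b c = refl
  swap true  b c = ∧-comm b c

endsAt-U-zero : ∀ m → endsAt (stepᵐ m U) 0 ≡ false
endsAt-U-zero nothing  = refl
endsAt-U-zero (just h) = refl

endsAt-U : ∀ m j → endsAt (stepᵐ m U) (suc j) ≡ endsAt m j
endsAt-U nothing  j = refl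
endsAt-U (just h) j = refl

endsAt-D : ∀ m j → endsAt (stepᵐ m D) j ≡ endsAt m (suc j)
endsAt-D nothing        j = refl
endsAt-D (just zero)    j = refl
endsAt-D (just (suc h)) j = refl

endsAt-R : ∀ m j → endsAt (stepᵐ m R) j ≡ endsAt m (suc j)
endsAt-R nothing        j = refl
endsAt-R (just zero)    j = refl
endsAt-R (just (suc h)) j = refl

endsAt-L : ∀ m j → endsAt (stepᵐ m L) j ≡ endsAt m j
endsAt-L nothing  j = refl
endsAt-L (just h) j = refl

byLast : ∀ b s → indicator b
  ≡ indicator (b ∧ lastOf s ≡ᴸ up) ℕ.+ indicator (b ∧ lastOf s ≡ᴸ red) ℕ.+ indicator (b ∧ lastOf s ≡ᴸ other)
byLast false s = refl
byLast true  U = refl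
byLast true  D = refl
byLast true  R = refl
byLast true  L = refl

byLast-U : ∀ b s → indicator (b ∧ not (forbiddenPair s U))
  ≡ indicator (b ∧ lastOf s ≡ᴸ up) ℕ.+ indicator (b ∧ lastOf s ≡ᴸ other)
byLast-U false s = refl
byLast-U true  U = refl
byLast-U true  D = refl
byLast-U true  R = refl
byLast-U true  L = refl

byLast-R : ∀ b s → indicator (b ∧ not (forbiddenPair s R))
  ≡ indicator (b ∧ lastOf s ≡ᴸ red) ℕ.+ indicator (b ∧ lastOf s ≡ᴸ other)
byLast-R false s = refl
byLast-R true  U = refl
byLast-R true  D = refl
byLast-R true  R = refl
byLast-R true  L = refl

byLast-unforbidden : ∀ t → (∀ s → forbiddenPair s t ≡ false) → ∀ b s → indicator (b ∧ not (forbiddenPair s t))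
  ≡ indicator (b ∧ lastOf s ≡ᴸ up) ℕ.+ indicator (b ∧ lastOf s ≡ᴸ red) ℕ.+ indicator (b ∧ lastOf s ≡ᴸ other)
byLast-unforbidden t free b s rewrite free s | ∧-identityʳ b = byLast b s

endsWith : ℕ → Last → List Step → Bool
endsWith j c w = isPSMP j w ∧ lastOf (lastStep w) ≡ᴸ c

ending : ℕ → ℕ → Last → ℕ
ending n j c = sumBy (indicator ∘ endsWith j c) (words n)

total : ℕ → ℕ → ℕ
total n j = ending n j up ℕ.+ ending n j red ℕ.+ ending n j other

endingWith : ℕ → ℕ → Step → ℕ
endingWith n j s = sumBy (λ w → indicator (isPSMP j (w ∷ʳ s))) (words n)

ending-suc : ∀ n j c → ending (suc n) j c ≡ sumBy (λ s → indicator (lastOf s ≡ᴸ c) ℕ.* endingWith n j s) allSteps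
ending-suc n j c = trans (sumBy-words-∷ʳ (indicator ∘ endsWith j c) n)
  (sumBy-cong allSteps λ s → trans (sumBy-cong (words n) (λ w → byFinalStep w s))
                                   (sumBy-*ˡ (indicator (lastOf s ≡ᴸ c)) _ (words n)))
  where
  byFinalStep : ∀ w s → indicator (endsWith j c (w ∷ʳ s)) ≡ indicator (lastOf s ≡ᴸ c) ℕ.* indicator (isPSMP j (w ∷ʳ s))
  byFinalStep w s rewrite lastStep-∷ʳ w s =
    trans (indicator-∧ (isPSMP j (w ∷ʳ s)) _) (ℕP.*-comm (indicator (isPSMP j (w ∷ʳ s))) _)

endingWith-shift : ∀ n j j′ s → (∀ m → endsAt (stepᵐ m s) j ≡ endsAt m j′) →
  endingWith n j s ≡ sumBy (λ w → indicator (isPSMP j′ w ∧ not (forbiddenPair (lastStep w) s))) (words n)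
endingWith-shift n j j′ s shift = sumBy-cong (words n) λ w →
  cong indicator (trans (isPSMP-∷ʳ j w s) (cong (λ e → (noForbidden w ∧ e) ∧ _) (shift (run 0 w))))

total-byLast : ∀ n j (f : List Step → ℕ) →
  (∀ w → f w ≡ indicator (endsWith j up w) ℕ.+ indicator (endsWith j red w) ℕ.+ indicator (endsWith j other w)) →
  sumBy f (words n) ≡ total n j
total-byLast n j f split = begin
  sumBy f (words n)
    ≡⟨ sumBy-cong (words n) split ⟩
  sumBy (λ w → indicator (endsWith j up w) ℕ.+ indicator (endsWith j red w) ℕ.+ indicator (endsWith j other w)) (words n)
    ≡⟨ sumBy-+ _ (indicator ∘ endsWith j other) (words n) ⟩
  sumBy (λ w → indicator (endsWith j up w) ℕ.+ indicator (endsWith j red w)) (words n) ℕ.+ ending n j other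
    ≡⟨ cong (ℕ._+ ending n j other) (sumBy-+ (indicator ∘ endsWith j up) (indicator ∘ endsWith j red) (words n)) ⟩
  total n j ∎
  where open ≡-Reasoning

a≡total : ∀ n j → a n j ≡ total n j
a≡total n j = trans (length-filterᵇ (isPSMP j) (words n))
                    (total-byLast n j _ (λ w → byLast (isPSMP j w) (lastStep w)))

ending-suc-up : ∀ n j → ending (suc n) j up ≡ endingWith n j U
ending-suc-up n j = trans (ending-suc n j up) (trans (ℕP.+-identityʳ _) (ℕP.+-identityʳ _))

ending-suc-red : ∀ n j → ending (suc n) j red ≡ endingWith n j R
ending-suc-red n j = trans (ending-suc n j red) (trans (ℕP.+-identityʳ _) (ℕP.+-identityʳ _))

ending-suc-other : ∀ n j → ending (suc n) j other ≡ endingWith n j D ℕ.+ endingWith n j L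
ending-suc-other n j = trans (ending-suc n j other)
  (cong₂ ℕ._+_ (ℕP.+-identityʳ (endingWith n j D))
                (trans (ℕP.+-identityʳ (endingWith n j L ℕ.+ 0)) (ℕP.+-identityʳ (endingWith n j L))))

endingWith-U-zero : ∀ n → endingWith n 0 U ≡ 0
endingWith-U-zero n = trans (sumBy-cong (words n) noPath) (sumBy-zero (words n))
  where
  noPath : ∀ w → indicator (isPSMP 0 (w ∷ʳ U)) ≡ 0
  noPath w rewrite isPSMP-∷ʳ 0 w U | endsAt-U-zero (run 0 w) | ∧-zeroʳ (noForbidden w) = refl

endingWith-U : ∀ n j → endingWith n (suc j) U ≡ ending n j up ℕ.+ ending n j other
endingWith-U n j = trans (endingWith-shift n (suc j) j U (λ m → endsAt-U m j))
  (trans (sumBy-cong (words n) (λ w → byLast-U (isPSMP j w) (lastStep w)))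
         (sumBy-+ (indicator ∘ endsWith j up) (indicator ∘ endsWith j other) (words n)))

endingWith-R : ∀ n j → endingWith n j R ≡ ending n (suc j) red ℕ.+ ending n (suc j) other
endingWith-R n j = trans (endingWith-shift n j (suc j) R (λ m → endsAt-R m j))
  (trans (sumBy-cong (words n) (λ w → byLast-R (isPSMP (suc j) w) (lastStep w)))
         (sumBy-+ (indicator ∘ endsWith (suc j) red) (indicator ∘ endsWith (suc j) other) (words n)))

endingWith-D : ∀ n j → endingWith n j D ≡ total n (suc j)
endingWith-D n j = trans (endingWith-shift n j (suc j) D (λ m → endsAt-D m j))
  (total-byLast n (suc j) _ (λ w → byLast-unforbidden D (λ { U → refl ; D → refl ; R → refl ; L → refl })
                                                       (isPSMP (suc j) w) (lastStep w)))

endingWith-L : ∀ n j → endingWith n j L ≡ total n j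
endingWith-L n j = trans (endingWith-shift n j j L (λ m → endsAt-L m j))
  (total-byLast n j _ (λ w → byLast-unforbidden L (λ { U → refl ; D → refl ; R → refl ; L → refl })
                                                 (isPSMP j w) (lastStep w)))

recurrence-up-zero : ∀ n → ending (suc n) 0 up ≡ 0
recurrence-up-zero n = trans (ending-suc-up n 0) (endingWith-U-zero n)

recurrence-up : ∀ n j → ending (suc n) (suc j) up ≡ ending n j up ℕ.+ ending n j other
recurrence-up n j = trans (ending-suc-up n (suc j)) (endingWith-U n j)

recurrence-red : ∀ n j → ending (suc n) j red ≡ ending n (suc j) red ℕ.+ ending n (suc j) other
recurrence-red n j = trans (ending-suc-red n j) (endingWith-R n j)

recurrence-other : ∀ n j → ending (suc n) j other ≡ total n (suc j) ℕ.+ total n j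
recurrence-other n j = trans (ending-suc-other n j) (cong₂ ℕ._+_ (endingWith-D n j) (endingWith-L n j))

sumUpTo : (ℕ → ℚ) → ℕ → ℚ
sumUpTo φ zero    = φ 0
sumUpTo φ (suc k) = sumUpTo φ k + φ (suc k)

sumUpTo-cong≤ : ∀ {φ ψ} k → (∀ i → i ℕ.≤ k → φ i ≡ ψ i) → sumUpTo φ k ≡ sumUpTo ψ k
sumUpTo-cong≤ zero    φ≗ψ = φ≗ψ 0 z≤n
sumUpTo-cong≤ (suc k) φ≗ψ = cong₂ _+_ (sumUpTo-cong≤ k (λ i i≤k → φ≗ψ i (ℕP.m≤n⇒m≤1+n i≤k)))
                                       (φ≗ψ (suc k) ℕP.≤-refl)

sumUpTo-cong : ∀ {φ ψ} k → (∀ i → φ i ≡ ψ i) → sumUpTo φ k ≡ sumUpTo ψ k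
sumUpTo-cong k φ≗ψ = sumUpTo-cong≤ k (λ i _ → φ≗ψ i)

sumUpTo-zero : ∀ k → sumUpTo (λ _ → 0ℚ) k ≡ 0ℚ
sumUpTo-zero zero    = refl
sumUpTo-zero (suc k) = cong (_+ 0ℚ) (sumUpTo-zero k)

sumUpTo-+ : ∀ φ ψ k → sumUpTo (λ i → φ i + ψ i) k ≡ sumUpTo φ k + sumUpTo ψ k
sumUpTo-+ φ ψ zero    = refl
sumUpTo-+ φ ψ (suc k) = trans (cong (_+ (φ (suc k) + ψ (suc k))) (sumUpTo-+ φ ψ k))
                              (interchange (sumUpTo φ k) (sumUpTo ψ k) (φ (suc k)) (ψ (suc k)))
  where open CommutativeSemigroupProperties (CommutativeMonoid.commutativeSemigroup ℚP.+-0-commutativeMonoid)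
                using (interchange)

sumUpTo-*ˡ : ∀ c φ k → sumUpTo (λ i → c * φ i) k ≡ c * sumUpTo φ k
sumUpTo-*ˡ c φ zero    = refl
sumUpTo-*ˡ c φ (suc k) = trans (cong (_+ (c * φ (suc k))) (sumUpTo-*ˡ c φ k))
                               (sym (ℚP.*-distribˡ-+ c (sumUpTo φ k) (φ (suc k))))

sumUpTo-*ʳ : ∀ c φ k → sumUpTo (λ i → φ i * c) k ≡ sumUpTo φ k * c
sumUpTo-*ʳ c φ k = trans (sumUpTo-cong k (λ i → ℚP.*-comm (φ i) c))
                         (trans (sumUpTo-*ˡ c φ k) (ℚP.*-comm c (sumUpTo φ k)))

sumUpTo-suc : ∀ φ k → sumUpTo φ (suc k) ≡ φ 0 + sumUpTo (φ ∘ suc) k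
sumUpTo-suc φ zero    = refl
sumUpTo-suc φ (suc k) = trans (cong (_+ φ (suc (suc k))) (sumUpTo-suc φ k))
                              (ℚP.+-assoc (φ 0) (sumUpTo (φ ∘ suc) k) (φ (suc (suc k))))

sumUpTo-reverse : ∀ φ k → sumUpTo φ k ≡ sumUpTo (λ i → φ (k ∸ i)) k
sumUpTo-reverse φ zero    = refl
sumUpTo-reverse φ (suc k) = begin
  sumUpTo φ k + φ (suc k)                   ≡⟨ cong (_+ φ (suc k)) (sumUpTo-reverse φ k) ⟩
  sumUpTo (λ i → φ (k ∸ i)) k + φ (suc k)   ≡⟨ ℚP.+-comm _ (φ (suc k)) ⟩
  φ (suc k) + sumUpTo (λ i → φ (k ∸ i)) k   ≡⟨ sumUpTo-suc (λ i → φ (suc k ∸ i)) k ⟨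
  sumUpTo (λ i → φ (suc k ∸ i)) (suc k)     ∎
  where open ≡-Reasoning

sumUpTo-triangle : ∀ (ψ : ℕ → ℕ → ℚ) n →
  sumUpTo (λ i → sumUpTo (λ a → ψ a i) i) n ≡ sumUpTo (λ a → sumUpTo (λ b → ψ a (a ℕ.+ b)) (n ∸ a)) n
sumUpTo-triangle ψ zero    = refl
sumUpTo-triangle ψ (suc n) = begin
  sumUpTo (λ i → sumUpTo (λ a → ψ a i) i) n + sumUpTo (λ a → ψ a (suc n)) (suc n)
    ≡⟨ cong (_+ sumUpTo (λ a → ψ a (suc n)) (suc n)) (sumUpTo-triangle ψ n) ⟩
  rows n + (sumUpTo (λ a → ψ a (suc n)) n + ψ (suc n) (suc n))
    ≡⟨ ℚP.+-assoc (rows n) _ _ ⟨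
  (rows n + sumUpTo (λ a → ψ a (suc n)) n) + ψ (suc n) (suc n)
    ≡⟨ cong₂ _+_ (sumUpTo-+ _ _ n) (cong (ψ (suc n)) (ℕP.+-identityʳ (suc n))) ⟨
  sumUpTo (λ a → row a (n ∸ a) + ψ a (suc n)) n + ψ (suc n) (suc n ℕ.+ 0)
    ≡⟨ cong (_+ ψ (suc n) (suc n ℕ.+ 0)) (sumUpTo-cong≤ n extendRow) ⟩
  sumUpTo (λ a → row a (suc n ∸ a)) n + row (suc n) 0
    ≡⟨ cong (λ x → sumUpTo (λ a → row a (suc n ∸ a)) n + row (suc n) x) (ℕP.n∸n≡0 n) ⟨
  sumUpTo (λ a → row a (suc n ∸ a)) (suc n) ∎
  where
  open ≡-Reasoning
  row : ℕ → ℕ → ℚ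
  row a m = sumUpTo (λ b → ψ a (a ℕ.+ b)) m
  rows : ℕ → ℚ
  rows n = sumUpTo (λ a → row a (n ∸ a)) n
  extendRow : ∀ a → a ℕ.≤ n → row a (n ∸ a) + ψ a (suc n) ≡ row a (suc n ∸ a)
  extendRow a a≤n rewrite ℕP.+-∸-assoc 1 a≤n =
    cong (row a (n ∸ a) +_) (cong (ψ a) (sym (trans (ℕP.+-suc a (n ∸ a)) (cong suc (ℕP.m+[n∸m]≡n a≤n)))))

-- The ring of formal power series

⊗-as-sum : ∀ f g n → (f ⊗ g) n ≡ sumUpTo (λ i → f i * g (n ∸ i)) n
⊗-as-sum f g n = go n
  where
  go : ∀ k → conv f g n k ≡ sumUpTo (λ i → f i * g (n ∸ i)) k
  go zero    = refl
  go (suc k) = cong (_+ (f (suc k) * g (n ∸ suc k))) (go k)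

⊗-suc : ∀ f g n → (f ⊗ g) (suc n) ≡ f 0 * g (suc n) + ((f ∘ suc) ⊗ g) n
⊗-suc f g n = trans (⊗-as-sum f g (suc n))
                    (trans (sumUpTo-suc (λ i → f i * g (suc n ∸ i)) n)
                           (cong (f 0 * g (suc n) +_) (sym (⊗-as-sum (f ∘ suc) g n))))

⊗-cong : ∀ {f f′ g g′} → f ≈ₛ f′ → g ≈ₛ g′ → f ⊗ g ≈ₛ f′ ⊗ g′
⊗-cong {f} {f′} {g} {g′} f≈f′ g≈g′ n = begin
  (f ⊗ g) n                             ≡⟨ ⊗-as-sum f g n ⟩
  sumUpTo (λ i → f i * g (n ∸ i)) n     ≡⟨ sumUpTo-cong n (λ i → cong₂ _*_ (f≈f′ i) (g≈g′ (n ∸ i))) ⟩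
  sumUpTo (λ i → f′ i * g′ (n ∸ i)) n   ≡⟨ ⊗-as-sum f′ g′ n ⟨
  (f′ ⊗ g′) n                           ∎
  where open ≡-Reasoning

⊗-comm : ∀ f g → f ⊗ g ≈ₛ g ⊗ f
⊗-comm f g n = begin
  (f ⊗ g) n                                         ≡⟨ ⊗-as-sum f g n ⟩
  sumUpTo (λ i → f i * g (n ∸ i)) n                 ≡⟨ sumUpTo-reverse (λ i → f i * g (n ∸ i)) n ⟩
  sumUpTo (λ i → f (n ∸ i) * g (n ∸ (n ∸ i))) n     ≡⟨ sumUpTo-cong≤ n swapFactors ⟩
  sumUpTo (λ i → g i * f (n ∸ i)) n                 ≡⟨ ⊗-as-sum g f n ⟨
  (g ⊗ f) n                                         ∎
  where
  open ≡-Reasoning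
  swapFactors : ∀ i → i ℕ.≤ n → f (n ∸ i) * g (n ∸ (n ∸ i)) ≡ g i * f (n ∸ i)
  swapFactors i i≤n = trans (cong (λ x → f (n ∸ i) * g x) (ℕP.m∸[m∸n]≡n i≤n)) (ℚP.*-comm (f (n ∸ i)) (g i))

⊗-distribˡ : ∀ f g h → f ⊗ (g ⊕ h) ≈ₛ f ⊗ g ⊕ f ⊗ h
⊗-distribˡ f g h n = begin
  (f ⊗ (g ⊕ h)) n
    ≡⟨ ⊗-as-sum f (g ⊕ h) n ⟩
  sumUpTo (λ i → f i * (g (n ∸ i) + h (n ∸ i))) n
    ≡⟨ sumUpTo-cong n (λ i → ℚP.*-distribˡ-+ (f i) (g (n ∸ i)) (h (n ∸ i))) ⟩
  sumUpTo (λ i → f i * g (n ∸ i) + f i * h (n ∸ i)) n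
    ≡⟨ sumUpTo-+ _ _ n ⟩
  sumUpTo (λ i → f i * g (n ∸ i)) n + sumUpTo (λ i → f i * h (n ∸ i)) n
    ≡⟨ cong₂ _+_ (⊗-as-sum f g n) (⊗-as-sum f h n) ⟨
  (f ⊗ g ⊕ f ⊗ h) n ∎
  where open ≡-Reasoning

⊗-distribʳ : ∀ f g h → (g ⊕ h) ⊗ f ≈ₛ g ⊗ f ⊕ h ⊗ f
⊗-distribʳ f g h n = trans (⊗-comm (g ⊕ h) f n)
  (trans (⊗-distribˡ f g h n) (cong₂ _+_ (⊗-comm f g n) (⊗-comm f h n)))

⊗-assoc : ∀ f g h → (f ⊗ g) ⊗ h ≈ₛ f ⊗ (g ⊗ h)
⊗-assoc f g h n = begin
  ((f ⊗ g) ⊗ h) n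
    ≡⟨ ⊗-as-sum (f ⊗ g) h n ⟩
  sumUpTo (λ i → (f ⊗ g) i * h (n ∸ i)) n
    ≡⟨ sumUpTo-cong n (λ i → trans (cong (_* h (n ∸ i)) (⊗-as-sum f g i))
                                   (sym (sumUpTo-*ʳ (h (n ∸ i)) (λ a → f a * g (i ∸ a)) i))) ⟩
  sumUpTo (λ i → sumUpTo (λ a → (f a * g (i ∸ a)) * h (n ∸ i)) i) n
    ≡⟨ sumUpTo-triangle (λ a i → (f a * g (i ∸ a)) * h (n ∸ i)) n ⟩
  sumUpTo (λ a → sumUpTo (λ b → (f a * g ((a ℕ.+ b) ∸ a)) * h (n ∸ (a ℕ.+ b))) (n ∸ a)) n
    ≡⟨ sumUpTo-cong n (λ a → sumUpTo-cong (n ∸ a) (λ b →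
         trans (cong₂ (λ x y → (f a * g x) * h y) (ℕP.m+n∸m≡n a b) (sym (ℕP.∸-+-assoc n a b)))
               (ℚP.*-assoc (f a) (g b) (h (n ∸ a ∸ b))))) ⟩
  sumUpTo (λ a → sumUpTo (λ b → f a * (g b * h (n ∸ a ∸ b))) (n ∸ a)) n
    ≡⟨ sumUpTo-cong n (λ a → trans (sumUpTo-*ˡ (f a) (λ b → g b * h (n ∸ a ∸ b)) (n ∸ a))
                                   (cong (f a *_) (sym (⊗-as-sum g h (n ∸ a))))) ⟩
  sumUpTo (λ a → f a * (g ⊗ h) (n ∸ a)) n
    ≡⟨ ⊗-as-sum f (g ⊗ h) n ⟨
  (f ⊗ (g ⊗ h)) n ∎
  where open ≡-Reasoning

zero-⊗ : ∀ f n → ((λ _ → 0ℚ) ⊗ f) n ≡ 0ℚ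
zero-⊗ f n = trans (⊗-as-sum (λ _ → 0ℚ) f n)
                   (trans (sumUpTo-cong n (λ i → ℚP.*-zeroˡ (f (n ∸ i)))) (sumUpTo-zero n))

const-⊗ : ∀ c f n → (const c ⊗ f) n ≡ c * f n
const-⊗ c f zero    = refl
const-⊗ c f (suc n) = trans (⊗-suc (const c) f n)
                            (trans (cong (c * f (suc n) +_) (zero-⊗ f n)) (ℚP.+-identityʳ _))

⊗-identityˡ : ∀ f → one ⊗ f ≈ₛ f
⊗-identityˡ f n = trans (const-⊗ 1ℚ f n) (ℚP.*-identityˡ (f n))

zS-⊗-zero : ∀ f → (zS ⊗ f) 0 ≡ 0ℚ
zS-⊗-zero f = ℚP.*-zeroˡ (f 0)

zS-⊗-suc : ∀ f n → (zS ⊗ f) (suc n) ≡ f n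
zS-⊗-suc f n = trans (⊗-suc zS f n)
  (trans (cong₂ _+_ (ℚP.*-zeroˡ (f (suc n))) (⊗-identityˡ f n)) (ℚP.+-identityˡ (f n)))

negₛ : Series → Series
negₛ f n = - f n

series-isCommutativeRing : IsCommutativeRing _≈ₛ_ _⊕_ _⊗_ negₛ (λ _ → 0ℚ) one
series-isCommutativeRing = record
  { isRing = record
    { +-isAbelianGroup = Pointwise.isAbelianGroup ℕ ℚP.+-0-isAbelianGroup
    ; *-cong           = ⊗-cong
    ; *-assoc          = ⊗-assoc
    ; *-identity       = ⊗-identityˡ , (λ f n → trans (⊗-comm f one n) (⊗-identityˡ f n))
    ; distrib          = ⊗-distribˡ , ⊗-distribʳ
    }
  ; *-comm = ⊗-comm
  }

series-commutativeRing : CommutativeRing _ _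
series-commutativeRing = record { isCommutativeRing = series-isCommutativeRing }

module Ser = CommutativeRing series-commutativeRing


const-+ : ∀ a b → const (a + b) ≈ₛ const a ⊕ const b
const-+ a b zero    = refl
const-+ a b (suc n) = refl

const-* : ∀ a b → const (a * b) ≈ₛ const a ⊗ const b
const-* a b n = sym (trans (const-⊗ a (const b) n) (scaled n))
  where
  scaled : ∀ n → a * const b n ≡ const (a * b) n
  scaled zero    = refl
  scaled (suc n) = ℚP.*-zeroʳ a

const-homomorphism : CommutativeRing.rawRing ℚP.+-*-commutativeRing
                       ACR.-Raw-AlmostCommutative⟶ ACR.fromCommutativeRing series-commutativeRing
const-homomorphism = record
  { ⟦_⟧    = const
  ; +-homo = const-+
  ; *-homo = const-*
  ; -‿homo = λ { a zero → refl ; a (suc n) → refl }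
  ; 0-homo = λ { zero → refl ; (suc n) → refl }
  ; 1-homo = λ _ → refl
  }

const-≟ : ∀ a b → Maybe (const a ≈ₛ const b)
const-≟ a b with a ℚP.≟ b
... | yes refl = just (λ _ → refl)
... | no _     = nothing

open import Algebra.Solver.Ring (CommutativeRing.rawRing ℚP.+-*-commutativeRing)
  (ACR.fromCommutativeRing series-commutativeRing) const-homomorphism const-≟
  using (Polynomial; con; _:+_; _:*_; _:-_; solve; _:=_)


-- `poly cs` as an expression in zS, so that the ring solver can treat z as a variable.
horner : List ℚ → Series
horner []       = const 0ℚ
horner (c ∷ cs) = const c ⊕ zS ⊗ horner cs

poly≈horner : ∀ cs → poly cs ≈ₛ horner cs
poly≈horner []       zero    = refl
poly≈horner []       (suc n) = refl
poly≈horner (c ∷ cs) zero    = sym (trans (cong (c +_) (zS-⊗-zero (horner cs))) (ℚP.+-identityʳ c))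
poly≈horner (c ∷ cs) (suc n) = sym (trans (ℚP.+-identityˡ _)
                                          (trans (zS-⊗-suc (horner cs) n) (sym (poly≈horner cs n))))

hornerₚ : ∀ {k} → List ℚ → Polynomial k → Polynomial k
hornerₚ []       x = con 0ℚ
hornerₚ (c ∷ cs) x = con c :+ x :* hornerₚ cs x

^ₛ-cong : ∀ {f g} k → f ≈ₛ g → f ^ₛ k ≈ₛ g ^ₛ k
^ₛ-cong zero    f≈g = Ser.refl
^ₛ-cong (suc k) f≈g = ⊗-cong f≈g (^ₛ-cong k f≈g)

≈-modulo-vanishing : ∀ {a b r} q → r ≈ₛ (λ _ → 0ℚ) → a ⊕ q ⊗ r ≈ₛ b → a ≈ₛ b
≈-modulo-vanishing {a} {b} {r} q r≈0 a+qr≈b = begin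
  a                    ≈⟨ Ser.+-identityʳ a ⟨
  a ⊕ (λ _ → 0ℚ)       ≈⟨ Ser.+-cong (Ser.refl {a}) (Ser.zeroʳ q) ⟨
  a ⊕ q ⊗ (λ _ → 0ℚ)   ≈⟨ Ser.+-cong (Ser.refl {a}) (Ser.*-cong (Ser.refl {q}) r≈0) ⟨
  a ⊕ q ⊗ r            ≈⟨ a+qr≈b ⟩
  b                    ∎
  where open SetoidReasoning Ser.setoid

-- Uniqueness of solutions, coefficient by coefficient

Agree : ℕ → Series → Series → Set
Agree n f g = ∀ m → m < n → f m ≡ g m

agree-⊕ : ∀ {n f f′ g g′} → Agree n f f′ → Agree n g g′ → Agree n (f ⊕ g) (f′ ⊕ g′)
agree-⊕ f≈f′ g≈g′ m m<n = cong₂ _+_ (f≈f′ m m<n) (g≈g′ m m<n)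

agree-⊗ : ∀ {n f g} h → Agree n f g → Agree n (h ⊗ f) (h ⊗ g)
agree-⊗ {f = f} {g} h f≈g m m<n = begin
  (h ⊗ f) m                           ≡⟨ ⊗-as-sum h f m ⟩
  sumUpTo (λ i → h i * f (m ℕ.∸ i)) m ≡⟨ sumUpTo-cong m (λ i → cong (h i *_) (f≈g (m ℕ.∸ i) (ℕP.≤-<-trans (ℕP.m∸n≤m m i) m<n))) ⟩
  sumUpTo (λ i → h i * g (m ℕ.∸ i)) m ≡⟨ ⊗-as-sum h g m ⟨
  (h ⊗ g) m                           ∎
  where open ≡-Reasoning

agree-zS : ∀ {n f g} → Agree n f g → (zS ⊗ f) n ≡ (zS ⊗ g) n
agree-zS {zero}  {f} {g} _   = trans (zS-⊗-zero f) (sym (zS-⊗-zero g))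
agree-zS {suc n} {f} {g} f≈g = trans (zS-⊗-suc f n) (trans (f≈g n ℕP.≤-refl) (sym (zS-⊗-suc g n)))

*-cancelˡ-≢0 : ∀ {a x y} → a ≢ 0ℚ → a * x ≡ a * y → x ≡ y
*-cancelˡ-≢0 {a} {x} {y} a≢0 ax≡ay = begin
  x                ≡⟨ ℚP.*-identityˡ x ⟨
  1ℚ * x           ≡⟨ cong (_* x) (ℚP.*-inverseˡ a) ⟨
  (1/ a * a) * x   ≡⟨ ℚP.*-assoc (1/ a) a x ⟩
  1/ a * (a * x)   ≡⟨ cong (1/ a *_) ax≡ay ⟩
  1/ a * (a * y)   ≡⟨ ℚP.*-assoc (1/ a) a y ⟨
  (1/ a * a) * y   ≡⟨ cong (_* y) (ℚP.*-inverseˡ a) ⟩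
  1ℚ * y           ≡⟨ ℚP.*-identityˡ y ⟩
  y                ∎
  where
  open ≡-Reasoning
  instance _ = ≢-nonZero a≢0

⊗-cancel-leading : ∀ {w f g n} → w 0 ≢ 0ℚ → Agree n f g → (w ⊗ f) n ≡ (w ⊗ g) n → f n ≡ g n
⊗-cancel-leading {n = zero}              w₀≢0 _   eq = *-cancelˡ-≢0 w₀≢0 eq
⊗-cancel-leading {w} {f} {g} {n = suc n} w₀≢0 f≈g eq = *-cancelˡ-≢0 w₀≢0 (∙-cancelʳ _ _ _ (begin
  w 0 * f (suc n) + ((w ∘ suc) ⊗ f) n ≡⟨ ⊗-suc w f n ⟨
  (w ⊗ f) (suc n)                     ≡⟨ eq ⟩
  (w ⊗ g) (suc n)                     ≡⟨ ⊗-suc w g n ⟩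
  w 0 * g (suc n) + ((w ∘ suc) ⊗ g) n ≡⟨ cong (w 0 * g (suc n) +_) (agree-⊗ (w ∘ suc) f≈g n ℕP.≤-refl) ⟨
  w 0 * g (suc n) + ((w ∘ suc) ⊗ f) n ∎))
  where open ≡-Reasoning

module _ {I : Set} (w : I → Series) (w₀≢0 : ∀ i → w i 0 ≢ 0ℚ) (F : (I → Series) → I → Series)
         (F-causal : ∀ {n Y Y′} → (∀ i → Agree n (Y i) (Y′ i)) → ∀ i → F Y i n ≡ F Y′ i n) where

  solution-unique : ∀ {Y Y′} → (∀ i → w i ⊗ Y i ≈ₛ F Y i) → (∀ i → w i ⊗ Y′ i ≈ₛ F Y′ i) → ∀ i → Y i ≈ₛ Y′ i
  solution-unique {Y} {Y′} Y-solves Y′-solves i n = agreeBelow (suc n) i n ℕP.≤-refl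
    where
    agreeBelow : ∀ n i → Agree n (Y i) (Y′ i)
    agreeBelow zero    i m ()
    agreeBelow (suc n) i m m<1+n with ℕP.m≤n⇒m<n∨m≡n (ℕP.≤-pred m<1+n)
    ... | inj₁ m<n  = agreeBelow n i m m<n
    ... | inj₂ refl = ⊗-cancel-leading (w₀≢0 i) (agreeBelow n i)
                        (trans (Y-solves i m) (trans (F-causal (agreeBelow n) i) (sym (Y′-solves i m))))

-- The system for the paths, and its rescaling

Fam : Set
Fam = Last → ℕ → Series

tot : Fam → ℕ → Series
tot Y j = Y up j ⊕ Y red j ⊕ Y other j

weight : Series → Last → Series
weight τ up    = one
weight τ red   = τ
weight τ other = τ

-- For τ = 1 these are the last-step decompositions of the generating functions of the paths ending at
-- height j with a last step of kind c; replacing the j-th unknowns by their multiples by τ^(j+1) gives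
-- the system for general τ.
rhs : Series → Fam → Last → ℕ → Series
rhs τ Y up    zero    = const 0ℚ
rhs τ Y up    (suc j) = zS ⊗ (τ ⊗ (Y up j ⊕ Y other j))
rhs τ Y red   j       = zS ⊗ (Y red (suc j) ⊕ Y other (suc j))
rhs τ Y other zero    = τ ⊗ τ ⊕ zS ⊗ (tot Y 1 ⊕ τ ⊗ tot Y 0)
rhs τ Y other (suc j) = zS ⊗ (tot Y (suc (suc j)) ⊕ τ ⊗ tot Y (suc j))

Solves : Series → Fam → Set
Solves τ Y = ∀ c j → weight τ c ⊗ Y c j ≈ₛ rhs τ Y c j

tot-agree : ∀ {n Y Y′} → (∀ c j → Agree n (Y c j) (Y′ c j)) → ∀ j → Agree n (tot Y j) (tot Y′ j)
tot-agree Y≈Y′ j = agree-⊕ (agree-⊕ (Y≈Y′ up j) (Y≈Y′ red j)) (Y≈Y′ other j)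

rhs-causal : ∀ τ {n Y Y′} → (∀ c j → Agree n (Y c j) (Y′ c j)) → ∀ c j → rhs τ Y c j n ≡ rhs τ Y′ c j n
rhs-causal τ Y≈Y′ up    zero    = refl
rhs-causal τ Y≈Y′ up    (suc j) = agree-zS (agree-⊗ τ (agree-⊕ (Y≈Y′ up j) (Y≈Y′ other j)))
rhs-causal τ Y≈Y′ red   j       = agree-zS (agree-⊕ (Y≈Y′ red (suc j)) (Y≈Y′ other (suc j)))
rhs-causal τ {n} Y≈Y′ other zero = cong ((τ ⊗ τ) n +_)
  (agree-zS (agree-⊕ (tot-agree Y≈Y′ 1) (agree-⊗ τ (tot-agree Y≈Y′ 0))))
rhs-causal τ Y≈Y′ other (suc j) = agree-zS (agree-⊕ (tot-agree Y≈Y′ (suc (suc j))) (agree-⊗ τ (tot-agree Y≈Y′ (suc j))))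

Solves-unique : ∀ {τ Y Y′} → τ 0 ≢ 0ℚ → Solves τ Y → Solves τ Y′ → ∀ c j → Y c j ≈ₛ Y′ c j
Solves-unique {τ} τ₀≢0 Y-solves Y′-solves = curry (solution-unique (weight τ ∘ proj₁) weight₀≢0
  (λ Y (c , j) → rhs τ (curry Y) c j) (λ Y≈Y′ (c , j) → rhs-causal τ (curry Y≈Y′) c j)
  (uncurry Y-solves) (uncurry Y′-solves))
  where
  weight₀≢0 : ∀ i → weight τ (proj₁ i) 0 ≢ 0ℚ
  weight₀≢0 (up    , _) ()
  weight₀≢0 (red   , _) = τ₀≢0
  weight₀≢0 (other , _) = τ₀≢0

rhs-cong : ∀ {τ τ′} Y → τ ≈ₛ τ′ → ∀ c j → rhs τ Y c j ≈ₛ rhs τ′ Y c j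
rhs-cong Y τ≈τ′ up    zero    = Ser.refl
rhs-cong Y τ≈τ′ up    (suc j) = Ser.*-cong Ser.refl (Ser.*-cong τ≈τ′ Ser.refl)
rhs-cong Y τ≈τ′ red   j       = Ser.refl
rhs-cong Y τ≈τ′ other zero    =
  Ser.+-cong (Ser.*-cong τ≈τ′ τ≈τ′) (Ser.*-cong Ser.refl (Ser.+-cong (Ser.refl {tot Y 1}) (Ser.*-cong τ≈τ′ Ser.refl)))
rhs-cong Y τ≈τ′ other (suc j) =
  Ser.*-cong Ser.refl (Ser.+-cong (Ser.refl {tot Y (suc (suc j))}) (Ser.*-cong τ≈τ′ Ser.refl))

weight-cong : ∀ {τ τ′} → τ ≈ₛ τ′ → ∀ c → weight τ c ≈ₛ weight τ′ c
weight-cong τ≈τ′ up    = Ser.refl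
weight-cong τ≈τ′ red   = τ≈τ′
weight-cong τ≈τ′ other = τ≈τ′

Solves-cong : ∀ {τ τ′ Y} → τ ≈ₛ τ′ → Solves τ Y → Solves τ′ Y
Solves-cong {Y = Y} τ≈τ′ Y-solves c j =
  Ser.trans (Ser.*-cong (Ser.sym (weight-cong τ≈τ′ c)) Ser.refl) (Ser.trans (Y-solves c j) (rhs-cong Y τ≈τ′ c j))

rescale : Series → Fam → Fam
rescale t X c j = X c j ⊗ (t ^ₛ suc j)

tot-rescale : ∀ t X j → tot (rescale t X) j ≈ₛ tot X j ⊗ (t ^ₛ suc j)
tot-rescale t X j = solve 4 (λ p a b c → a :* p :+ b :* p :+ c :* p := (a :+ b :+ c) :* p)
                            (λ _ → refl) (t ^ₛ suc j) (X up j) (X red j) (X other j)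

Solves-rescale : ∀ {σ X} t → Solves σ X → Solves (σ ⊗ t) (rescale t X)
Solves-rescale {σ} {X} t X-solves = λ
  { up zero → begin
      one ⊗ (X up 0 ⊗ (t ⊗ one))    ≈⟨ Ser.*-assoc one (X up 0) (t ⊗ one) ⟨
      (one ⊗ X up 0) ⊗ (t ⊗ one)    ≈⟨ Ser.*-cong (X-solves up 0) Ser.refl ⟩
      const 0ℚ ⊗ (t ⊗ one)          ≈⟨ solve 1 (λ p → con 0ℚ :* p := con 0ℚ) (λ _ → refl) (t ⊗ one) ⟩
      const 0ℚ                      ∎
  ; up (suc j) → begin
      one ⊗ (X up (suc j) ⊗ (t ⊗ (t ^ₛ suc j)))   ≈⟨ Ser.*-assoc one (X up (suc j)) _ ⟨
      (one ⊗ X up (suc j)) ⊗ (t ⊗ (t ^ₛ suc j))   ≈⟨ Ser.*-cong (X-solves up (suc j)) Ser.refl ⟩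
      zS ⊗ (σ ⊗ (X up j ⊕ X other j)) ⊗ (t ⊗ (t ^ₛ suc j))
        ≈⟨ solve 6 (λ z s t p a b → z :* (s :* (a :+ b)) :* (t :* p) := z :* ((s :* t) :* (a :* p :+ b :* p)))
                 (λ _ → refl) zS σ t (t ^ₛ suc j) (X up j) (X other j) ⟩
      zS ⊗ ((σ ⊗ t) ⊗ (Y up j ⊕ Y other j)) ∎
  ; red j → begin
      (σ ⊗ t) ⊗ (X red j ⊗ (t ^ₛ suc j))   ≈⟨ regroup (X red j) (t ^ₛ suc j) ⟩
      (σ ⊗ X red j) ⊗ (t ^ₛ suc (suc j))   ≈⟨ Ser.*-cong (X-solves red j) Ser.refl ⟩
      zS ⊗ (X red (suc j) ⊕ X other (suc j)) ⊗ (t ^ₛ suc (suc j))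
        ≈⟨ solve 4 (λ z p a b → z :* (a :+ b) :* p := z :* (a :* p :+ b :* p))
                 (λ _ → refl) zS (t ^ₛ suc (suc j)) (X red (suc j)) (X other (suc j)) ⟩
      zS ⊗ (Y red (suc j) ⊕ Y other (suc j)) ∎
  ; other zero → begin
      (σ ⊗ t) ⊗ (X other 0 ⊗ (t ⊗ one))   ≈⟨ regroup (X other 0) (t ⊗ one) ⟩
      (σ ⊗ X other 0) ⊗ (t ⊗ (t ⊗ one))   ≈⟨ Ser.*-cong (X-solves other 0) Ser.refl ⟩
      (σ ⊗ σ ⊕ zS ⊗ (tot X 1 ⊕ σ ⊗ tot X 0)) ⊗ (t ⊗ (t ⊗ one))
        ≈⟨ solve 5 (λ z s t a b → (s :* s :+ z :* (a :+ s :* b)) :* (t :* (t :* con 1ℚ))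
                               := (s :* t) :* (s :* t) :+ z :* (a :* (t :* (t :* con 1ℚ)) :+ (s :* t) :* (b :* (t :* con 1ℚ))))
                 (λ _ → refl) zS σ t (tot X 1) (tot X 0) ⟩
      (σ ⊗ t) ⊗ (σ ⊗ t) ⊕ zS ⊗ (tot X 1 ⊗ (t ^ₛ 2) ⊕ (σ ⊗ t) ⊗ (tot X 0 ⊗ (t ^ₛ 1)))
        ≈⟨ Ser.+-cong (Ser.refl {(σ ⊗ t) ⊗ (σ ⊗ t)}) (Ser.*-cong (Ser.refl {zS})
             (Ser.+-cong (Ser.sym (tot-rescale t X 1)) (Ser.*-cong (Ser.refl {σ ⊗ t}) (Ser.sym (tot-rescale t X 0))))) ⟩
      (σ ⊗ t) ⊗ (σ ⊗ t) ⊕ zS ⊗ (tot Y 1 ⊕ (σ ⊗ t) ⊗ tot Y 0) ∎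
  ; other (suc j) → begin
      (σ ⊗ t) ⊗ (X other (suc j) ⊗ (t ^ₛ suc (suc j)))   ≈⟨ regroup (X other (suc j)) (t ^ₛ suc (suc j)) ⟩
      (σ ⊗ X other (suc j)) ⊗ (t ^ₛ suc (suc (suc j)))   ≈⟨ Ser.*-cong (X-solves other (suc j)) Ser.refl ⟩
      zS ⊗ (tot X (suc (suc j)) ⊕ σ ⊗ tot X (suc j)) ⊗ (t ⊗ (t ^ₛ suc (suc j)))
        ≈⟨ solve 6 (λ z s t p a b → z :* (a :+ s :* b) :* (t :* p) := z :* (a :* (t :* p) :+ (s :* t) :* (b :* p)))
                 (λ _ → refl) zS σ t (t ^ₛ suc (suc j)) (tot X (suc (suc j))) (tot X (suc j)) ⟩
      zS ⊗ (tot X (suc (suc j)) ⊗ (t ^ₛ suc (suc (suc j))) ⊕ (σ ⊗ t) ⊗ (tot X (suc j) ⊗ (t ^ₛ suc (suc j))))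
        ≈⟨ Ser.*-cong (Ser.refl {zS}) (Ser.+-cong (Ser.sym (tot-rescale t X (suc (suc j))))
                                                  (Ser.*-cong (Ser.refl {σ ⊗ t}) (Ser.sym (tot-rescale t X (suc j))))) ⟩
      zS ⊗ (tot Y (suc (suc j)) ⊕ (σ ⊗ t) ⊗ tot Y (suc j)) ∎
  }
  where
  open SetoidReasoning Ser.setoid
  Y : Fam
  Y = rescale t X
  regroup : ∀ x p → (σ ⊗ t) ⊗ (x ⊗ p) ≈ₛ (σ ⊗ x) ⊗ (t ⊗ p)
  regroup = solve 4 (λ s t x p → (s :* t) :* (x :* p) := (s :* x) :* (t :* p)) (λ _ → refl) σ t

-- The explicit solution

two : ℚ
two = int (ℤ.+ 2)

Pc Oc Qc Wc Rc Tc : List ℚ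
Pc = 1ℚ ∷ - 1ℚ ∷ 1ℚ ∷ 1ℚ ∷ []
Oc = 1ℚ ∷ 1ℚ ∷ []
Qc = 1ℚ ∷ 1ℚ ∷ int ℤ.-[1+ 1 ] ∷ - 1ℚ ∷ []
Wc = 1ℚ ∷ int ℤ.-[1+ 3 ] ∷ two ∷ 0ℚ ∷ 1ℚ ∷ []
Rc = 1ℚ ∷ - two ∷ - 1ℚ ∷ []
Tc = 0ℚ ∷ two ∷ []

module _ (W : Series) (W²≈Wsq : W ⊗ W ≈ₛ Wsq) where

  τ₁ ρ ω twoZₕ : Series
  τ₁    = horner Pc ⊕ horner Oc ⊗ W
  ρ     = horner Rc ⊕ negₛ W
  ω     = const two ⊕ negₛ τ₁
  twoZₕ = const two ⊗ zS

  τ₁ₚ ρₚ ωₚ relₚ : ∀ {k} → Polynomial k → Polynomial k → Polynomial k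
  τ₁ₚ z w  = hornerₚ Pc z :+ hornerₚ Oc z :* w
  ρₚ  z w  = hornerₚ Rc z :- w
  ωₚ  z w  = con two :- τ₁ₚ z w
  relₚ z w = hornerₚ Oc z :* (w :* w :- hornerₚ Wc z)

  twoZₚ : ∀ {k} → Polynomial k → Polynomial k
  twoZₚ z = con two :* z

  rel≈0 : horner Oc ⊗ (W ⊗ W ⊕ negₛ (horner Wc)) ≈ₛ (λ _ → 0ℚ)
  rel≈0 = Ser.trans (Ser.*-cong Ser.refl W²−Wsq≈0) (Ser.zeroʳ (horner Oc))
    where
    W²−Wsq≈0 : W ⊗ W ⊕ negₛ (horner Wc) ≈ₛ (λ _ → 0ℚ)
    W²−Wsq≈0 n = trans (cong (λ x → x + - horner Wc n) (trans (W²≈Wsq n) (poly≈horner Wc n)))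
                       (ℚP.+-inverseʳ (horner Wc n))

  -- Paths ending at height j ≥ 1 have generating functions geometric in j with ratio u₁⁻¹, so after the
  -- rescaling by (2z u₁)^(j+1) the solution is (2z)^j times a series independent of j ≥ 1.
  κ : Last → ℕ → Series
  κ up    zero    = const 0ℚ
  κ up    (suc _) = τ₁
  κ red   _       = ρ
  κ other zero    = const two
  κ other (suc _) = ω

  K : Fam
  K c j = twoZₕ ^ₛ j ⊗ κ c j

  K-solves : Solves τ₁ K
  K-solves up zero = λ n → trans (⊗-identityˡ _ n) (⊗-identityˡ _ n)
  K-solves up (suc zero) =
    solve 2 (λ z w → con 1ℚ :* ((twoZₚ z :* con 1ℚ) :* τ₁ₚ z w)
                   := z :* (τ₁ₚ z w :* (con 1ℚ :* con 0ℚ :+ con 1ℚ :* con two)))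
            (λ _ → refl) zS W
  K-solves up (suc (suc j)) =
    solve 3 (λ z w q → con 1ℚ :* ((twoZₚ z :* (twoZₚ z :* q)) :* τ₁ₚ z w)
                     := z :* (τ₁ₚ z w :* ((twoZₚ z :* q) :* τ₁ₚ z w :+ (twoZₚ z :* q) :* ωₚ z w)))
            (λ _ → refl) zS W (twoZₕ ^ₛ j)
  K-solves red j = ≈-modulo-vanishing (twoZₕ ^ₛ j) rel≈0
    (solve 3 (λ z w q → τ₁ₚ z w :* (q :* ρₚ z w) :+ q :* relₚ z w
                     := z :* ((twoZₚ z :* q) :* ρₚ z w :+ (twoZₚ z :* q) :* ωₚ z w))
             (λ _ → refl) zS W (twoZₕ ^ₛ j))
  K-solves other zero = ≈-modulo-vanishing one rel≈0
    (solve 2 (λ z w → τ₁ₚ z w :* (con 1ℚ :* con two) :+ con 1ℚ :* relₚ z w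
                   := τ₁ₚ z w :* τ₁ₚ z w
                      :+ z :* (((twoZₚ z :* con 1ℚ) :* τ₁ₚ z w :+ (twoZₚ z :* con 1ℚ) :* ρₚ z w :+ (twoZₚ z :* con 1ℚ) :* ωₚ z w)
                               :+ τ₁ₚ z w :* (con 1ℚ :* con 0ℚ :+ con 1ℚ :* ρₚ z w :+ con 1ℚ :* con two)))
             (λ _ → refl) zS W)
  K-solves other (suc j) = ≈-modulo-vanishing (twoZₕ ^ₛ suc j) rel≈0
    (solve 3 (λ z w q → τ₁ₚ z w :* ((twoZₚ z :* q) :* ωₚ z w) :+ (twoZₚ z :* q) :* relₚ z w
                     := z :* (((twoZₚ z :* (twoZₚ z :* q)) :* τ₁ₚ z w :+ (twoZₚ z :* (twoZₚ z :* q)) :* ρₚ z w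
                                :+ (twoZₚ z :* (twoZₚ z :* q)) :* ωₚ z w)
                              :+ τ₁ₚ z w :* ((twoZₚ z :* q) :* τ₁ₚ z w :+ (twoZₚ z :* q) :* ρₚ z w :+ (twoZₚ z :* q) :* ωₚ z w)))
             (λ _ → refl) zS W (twoZₕ ^ₛ j))

  twoZ≈twoZₕ : twoZ ≈ₛ twoZₕ
  twoZ≈twoZₕ = Ser.trans (poly≈horner Tc) (solve 1 (λ z → hornerₚ Tc z := twoZₚ z) (λ _ → refl) zS)

  K-total : ∀ j → zS ⊗ onePlusZ ⊗ tot K j ≈ₛ (Q ⊕ const half ⊗ twoZu₂ W) ⊗ (twoZ ^ₛ suc j)
  K-total j = begin
    zS ⊗ onePlusZ ⊗ tot K j
      ≈⟨ Ser.*-cong (Ser.*-cong Ser.refl (poly≈horner Oc)) Ser.refl ⟩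
    zS ⊗ horner Oc ⊗ tot K j
      ≈⟨ closedForm j ⟩
    (horner Qc ⊕ const half ⊗ (horner Pc ⊕ negₛ (horner Oc ⊗ W))) ⊗ (twoZₕ ^ₛ suc j)
      ≈⟨ Ser.*-cong (Ser.+-cong (poly≈horner Qc) (Ser.*-cong Ser.refl (Ser.+-cong (poly≈horner Pc)
                      (Ser.-‿cong (Ser.*-cong (poly≈horner Oc) Ser.refl)))))
                    (^ₛ-cong (suc j) twoZ≈twoZₕ) ⟨
    (Q ⊕ const half ⊗ twoZu₂ W) ⊗ (twoZ ^ₛ suc j) ∎
    where
    open SetoidReasoning Ser.setoid
    closedForm : ∀ j → zS ⊗ horner Oc ⊗ tot K j
                     ≈ₛ (horner Qc ⊕ const half ⊗ (horner Pc ⊕ negₛ (horner Oc ⊗ W))) ⊗ (twoZₕ ^ₛ suc j)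
    closedForm zero = solve 2 (λ z w →
        z :* hornerₚ Oc z :* (con 1ℚ :* con 0ℚ :+ con 1ℚ :* ρₚ z w :+ con 1ℚ :* con two)
      := (hornerₚ Qc z :+ con half :* (hornerₚ Pc z :- hornerₚ Oc z :* w)) :* (twoZₚ z :* con 1ℚ))
      (λ _ → refl) zS W
    closedForm (suc j) = solve 3 (λ z w q →
        z :* hornerₚ Oc z :* ((twoZₚ z :* q) :* τ₁ₚ z w :+ (twoZₚ z :* q) :* ρₚ z w :+ (twoZₚ z :* q) :* ωₚ z w)
      := (hornerₚ Qc z :+ con half :* (hornerₚ Pc z :- hornerₚ Oc z :* w)) :* (twoZₚ z :* (twoZₚ z :* q)))
      (λ _ → refl) zS W (twoZₕ ^ₛ j)

fromℕ : ℕ → ℚ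
fromℕ m = int (ℤ.+ m)

fromℕ-+ : ∀ m k → fromℕ (m ℕ.+ k) ≡ fromℕ m + fromℕ k
fromℕ-+ m k = trans (ℚP./-cong {ℤ.+ (m ℕ.+ k)} {1} {ℤ.+ m ℤ.* ℤ.+ 1 ℤ.+ ℤ.+ k ℤ.* ℤ.+ 1} {1}
                       (sym (cong₂ ℤ._+_ (ℤP.*-identityʳ (ℤ.+ m)) (ℤP.*-identityʳ (ℤ.+ k)))) refl)
                   (sym (cong₂ _+_ (asMkℚ m) (asMkℚ k)))
  where
  asMkℚ : ∀ m → fromℕ m ≡ mkℚ (ℤ.+ m) 0 (Coprimality.sym (Coprimality.1-coprimeTo m))
  asMkℚ m = ℚP.↥p/↧p≡p (mkℚ (ℤ.+ m) 0 (Coprimality.sym (Coprimality.1-coprimeTo m)))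

X : Fam
X c j n = fromℕ (ending n j c)

fromℕ-total : ∀ n j → fromℕ (total n j) ≡ tot X j n
fromℕ-total n j = trans (fromℕ-+ (ending n j up ℕ.+ ending n j red) (ending n j other))
                        (cong (_+ X other j n) (fromℕ-+ (ending n j up) (ending n j red)))

A≈tot : ∀ j → A j ≈ₛ tot X j
A≈tot j n = trans (cong fromℕ (a≡total n j)) (fromℕ-total n j)

X-rhs : ∀ c j → X c j ≈ₛ rhs one X c j
X-rhs up    zero    zero    = refl
X-rhs up    zero    (suc n) = cong fromℕ (recurrence-up-zero n)
X-rhs up    (suc j) zero    = sym (zS-⊗-zero (one ⊗ (X up j ⊕ X other j)))
X-rhs up    (suc j) (suc n) = begin
  fromℕ (ending (suc n) (suc j) up)            ≡⟨ cong fromℕ (recurrence-up n j) ⟩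
  fromℕ (ending n j up ℕ.+ ending n j other)   ≡⟨ fromℕ-+ (ending n j up) (ending n j other) ⟩
  (X up j ⊕ X other j) n                       ≡⟨ ⊗-identityˡ (X up j ⊕ X other j) n ⟨
  (one ⊗ (X up j ⊕ X other j)) n               ≡⟨ zS-⊗-suc (one ⊗ (X up j ⊕ X other j)) n ⟨
  rhs one X up (suc j) (suc n)                 ∎
  where open ≡-Reasoning
X-rhs red   zero    zero    = sym (zS-⊗-zero (X red 1 ⊕ X other 1))
X-rhs red   (suc j) zero    = sym (zS-⊗-zero (X red (suc (suc j)) ⊕ X other (suc (suc j))))
X-rhs red   j       (suc n) = begin
  fromℕ (ending (suc n) j red)                              ≡⟨ cong fromℕ (recurrence-red n j) ⟩
  fromℕ (ending n (suc j) red ℕ.+ ending n (suc j) other)   ≡⟨ fromℕ-+ (ending n (suc j) red) (ending n (suc j) other) ⟩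
  (X red (suc j) ⊕ X other (suc j)) n                       ≡⟨ zS-⊗-suc (X red (suc j) ⊕ X other (suc j)) n ⟨
  rhs one X red j (suc n)                                   ∎
  where open ≡-Reasoning
X-rhs other zero    zero    = sym (cong (1ℚ +_) (zS-⊗-zero (tot X 1 ⊕ one ⊗ tot X 0)))
X-rhs other (suc j) zero    = sym (zS-⊗-zero (tot X (suc (suc j)) ⊕ one ⊗ tot X (suc j)))
X-rhs other zero    (suc n) = begin
  fromℕ (ending (suc n) 0 other)                ≡⟨ cong fromℕ (recurrence-other n 0) ⟩
  fromℕ (total n 1 ℕ.+ total n 0)               ≡⟨ trans (fromℕ-+ (total n 1) (total n 0)) (cong₂ _+_ (fromℕ-total n 1) (fromℕ-total n 0)) ⟩
  (tot X 1 ⊕ tot X 0) n                         ≡⟨ cong (tot X 1 n +_) (⊗-identityˡ (tot X 0) n) ⟨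
  (tot X 1 ⊕ one ⊗ tot X 0) n                   ≡⟨ zS-⊗-suc (tot X 1 ⊕ one ⊗ tot X 0) n ⟨
  (zS ⊗ (tot X 1 ⊕ one ⊗ tot X 0)) (suc n)       ≡⟨ ℚP.+-identityˡ _ ⟨
  0ℚ + (zS ⊗ (tot X 1 ⊕ one ⊗ tot X 0)) (suc n)  ≡⟨ cong (_+ (zS ⊗ (tot X 1 ⊕ one ⊗ tot X 0)) (suc n)) (const-⊗ 1ℚ one (suc n)) ⟨
  rhs one X other 0 (suc n)                     ∎
  where open ≡-Reasoning
X-rhs other (suc j) (suc n) = begin
  fromℕ (ending (suc n) (suc j) other)
    ≡⟨ cong fromℕ (recurrence-other n (suc j)) ⟩
  fromℕ (total n (suc (suc j)) ℕ.+ total n (suc j))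
    ≡⟨ trans (fromℕ-+ (total n (suc (suc j))) (total n (suc j))) (cong₂ _+_ (fromℕ-total n (suc (suc j))) (fromℕ-total n (suc j))) ⟩
  (tot X (suc (suc j)) ⊕ tot X (suc j)) n
    ≡⟨ cong (tot X (suc (suc j)) n +_) (⊗-identityˡ (tot X (suc j)) n) ⟨
  (tot X (suc (suc j)) ⊕ one ⊗ tot X (suc j)) n
    ≡⟨ zS-⊗-suc (tot X (suc (suc j)) ⊕ one ⊗ tot X (suc j)) n ⟨
  rhs one X other (suc j) (suc n) ∎
  where open ≡-Reasoning

X-solves : Solves one X
X-solves up    j = Ser.trans (⊗-identityˡ (X up j)) (X-rhs up j)
X-solves red   j = Ser.trans (⊗-identityˡ (X red j)) (X-rhs red j)
X-solves other j = Ser.trans (⊗-identityˡ (X other j)) (X-rhs other j)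

tot-cong : ∀ {Y Y′} → (∀ c j → Y c j ≈ₛ Y′ c j) → ∀ j → tot Y j ≈ₛ tot Y′ j
tot-cong Y≈Y′ j = Ser.+-cong (Ser.+-cong (Y≈Y′ up j) (Y≈Y′ red j)) (Y≈Y′ other j)

mainTheorem1 : (W : Series) → W ⊗ W ≈ₛ Wsq → W 0 ≡ 1ℚ → (j : ℕ) →
    A j ⊗ zS ⊗ onePlusZ ⊗ (twoZu₁ W ^ₛ suc j) ≈ₛ (Q ⊕ const half ⊗ twoZu₂ W) ⊗ (twoZ ^ₛ suc j)
mainTheorem1 W W²≈Wsq W₀≡1 j = begin
  A j ⊗ zS ⊗ onePlusZ ⊗ (t ^ₛ suc j)
    ≈⟨ Ser.*-cong (Ser.*-cong (Ser.*-cong (A≈tot j) Ser.refl) Ser.refl) Ser.refl ⟩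
  tot X j ⊗ zS ⊗ onePlusZ ⊗ (t ^ₛ suc j)
    ≈⟨ solve 4 (λ z o p a → a :* z :* o :* p := z :* o :* (a :* p)) (λ _ → refl) zS onePlusZ (t ^ₛ suc j) (tot X j) ⟩
  zS ⊗ onePlusZ ⊗ (tot X j ⊗ (t ^ₛ suc j))
    ≈⟨ Ser.*-cong Ser.refl (tot-rescale t X j) ⟨
  zS ⊗ onePlusZ ⊗ tot (rescale t X) j
    ≈⟨ Ser.*-cong Ser.refl (tot-cong rescaled≈K j) ⟩
  zS ⊗ onePlusZ ⊗ tot (K W W²≈Wsq) j
    ≈⟨ K-total W W²≈Wsq j ⟩
  (Q ⊕ const half ⊗ twoZu₂ W) ⊗ (twoZ ^ₛ suc j) ∎
  where
  open SetoidReasoning Ser.setoid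
  t : Series
  t = twoZu₁ W
  t₀≡two : t 0 ≡ two
  t₀≡two rewrite W₀≡1 = refl
  t₀≢0 : t 0 ≢ 0ℚ
  t₀≢0 t₀≡0 with trans (sym t₀≡two) t₀≡0
  ... | ()
  rescaled≈K : ∀ c j → rescale t X c j ≈ₛ K W W²≈Wsq c j
  rescaled≈K = Solves-unique t₀≢0
    (Solves-cong (⊗-identityˡ t) (Solves-rescale t X-solves))
    (Solves-cong (Ser.sym (Ser.+-cong (poly≈horner Pc) (Ser.*-cong (poly≈horner Oc) Ser.refl))) (K-solves W W²≈Wsq))
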